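{- Let $G$ be a finite graph with $\alpha(G)=2$ and let $\mathfrak A$ be a partition of $V(G)$ into exactly $\chi(G)$ independent sets. Let $\{v\}\in\mathfrak A$ be a singleton class and let $\mathfrak S=\{A\in\mathfrak A: |A|=2,\ |E(v,A)|=1\}$. If $\{a_1,a_2\},\{b_1,b_2\}\in\mathfrak S$ are two classes with $va_2,vb_2\in E(G)$, then $a_1b_1\in E(G)$.
   Context: $E(v,A)$ denotes the set of edges of $G$ joining $v$ to a vertex of $A$. -}

module Defs where

open import Data.Nat using (ℕ; _≤_)
open import Data.Bool using (Bool; true; false; _∧_)
open import Data.Fin using (Fin; _≟_)
open import Data.List using (List; length; filter; allFin)
open import Data.List.Relation.Unary.Unique.Propositional using (Unique)
open import Data.List.Membership.Propositional using (_∈_)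
open import Data.Product using (Σ; _×_; ∃)
open import Function.Definitions using (Surjective)
open import Relation.Binary.PropositionalEquality using (_≡_; _≢_)
open import Relation.Nullary using (¬_)
open import Relation.Nullary.Decidable using (⌊_⌋)

record Graph (n : ℕ) : Set where
  field
    adj       : Fin n → Fin n → Bool
    adj-sym   : ∀ u w → adj u w ≡ adj w u
    adj-irr   : ∀ u → adj u u ≡ false

open Graph public

Edge : ∀ {n} → Graph n → Fin n → Fin n → Set
Edge G u w = adj G u w ≡ true

IsIndependent : ∀ {n} → Graph n → List (Fin n) → Set
IsIndependent G xs = Unique xs × (∀ {u w} → u ∈ xs → w ∈ xs → ¬ Edge G u w)

IndependenceNumber : ∀ {n} → Graph n → ℕ → Set
IndependenceNumber G k =
  (Σ (List _) λ xs → IsIndependent G xs × length xs ≡ k) ×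
  (∀ xs → IsIndependent G xs → length xs ≤ k)

IsProperColouring : ∀ {n k} → Graph n → (Fin n → Fin k) → Set
IsProperColouring G c = ∀ u w → Edge G u w → c u ≢ c w

ChromaticNumber : ∀ {n} → Graph n → ℕ → Set
ChromaticNumber {n} G k =
  (Σ (Fin n → Fin k) λ c → IsProperColouring G c) ×
  (∀ m (c : Fin n → Fin m) → IsProperColouring G c → k ≤ m)

-- A partition of V(G) into exactly k independent sets: the classes are the
-- fibres of a proper colouring c : Fin n → Fin k, all of which are nonempty.
IsIndependentPartition : ∀ {n k} → Graph n → (Fin n → Fin k) → Set
IsIndependentPartition G c = IsProperColouring G c × Surjective _≡_ _≡_ c

SingletonClass : ∀ {n k} → (Fin n → Fin k) → Fin n → Set
SingletonClass c u = ∀ w → c w ≡ c u → w ≡ u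

PairClass : ∀ {n k} → (Fin n → Fin k) → Fin n → Fin n → Set
PairClass c a₁ a₂ =
  a₁ ≢ a₂ × c a₂ ≡ c a₁ × (∀ w → c w ≡ c a₁ → w ≡ a₁ ⊎' w ≡ a₂)
  where
  open import Data.Sum using () renaming (_⊎_ to _⊎'_)

edgesToClass : ∀ {n k} → Graph n → (Fin n → Fin k) → Fin n → Fin k → ℕ
edgesToClass {n} G c v i =
  length (filter (λ w → (⌊ c w ≟ i ⌋ ∧ adj G v w) Data.Bool.≟ true) (allFin n))
  where import Data.Bool

{-# OPTIONS --safe #-}
module Submission where

-- Since v has exactly one neighbour in each of the classes {a₁, a₂} and
-- {b₁, b₂}, namely a₂ and b₂, it is adjacent to neither a₁ nor b₁. The
-- vertices v, a₁, b₁ are distinct, so if a₁ b₁ were not an edge they would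
-- form an independent set of size 3, contradicting α(G) = 2.

open import Defs
open import Data.Nat using (ℕ; _≤_; s≤s; z≤n)
open import Data.Nat.Properties using (<⇒≱; n<1+n)
open import Data.Fin using (Fin; _≟_)
open import Data.Bool using (true; _∧_)
import Data.Bool as Bool
open import Data.List using (List; []; _∷_; length; filter; allFin)
open import Data.List.Relation.Unary.Any using (here; there)
open import Data.List.Relation.Unary.All using ([]; _∷_)
open import Data.List.Relation.Unary.AllPairs using ([]; _∷_)
open import Data.List.Membership.Propositional using (_∈_)
open import Data.List.Membership.Propositional.Properties using (∈-allFin; ∈-filter⁺)
open import Data.Product using (_,_; proj₂)
open import Function using (case_of_)
open import Relation.Nullary using (¬_; yes; no; contradiction)
open import Relation.Nullary.Decidable using (⌊_⌋; isYes≗does; dec-true)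
open import Relation.Binary.PropositionalEquality using (_≡_; _≢_; refl; sym; trans; subst; cong; cong₂)

distinct-∈⇒2≤length : ∀ {A : Set} {x y : A} {xs : List A}
  → x ∈ xs → y ∈ xs → x ≢ y → 2 ≤ length xs
distinct-∈⇒2≤length {xs = _ ∷ _ ∷ _} _ _ _ = s≤s (s≤s z≤n)
distinct-∈⇒2≤length {xs = _ ∷ []} (here refl) (here refl) x≢y = contradiction refl x≢y

module _ {n : ℕ} (G : Graph n) where

  ¬Edge-refl : ∀ u → ¬ Edge G u u
  ¬Edge-refl u e = case trans (sym (adj-irr G u)) e of λ ()

  ¬Edge-sym : ∀ {u w} → ¬ Edge G u w → ¬ Edge G w u
  ¬Edge-sym {u} {w} ¬uw wu = ¬uw (trans (adj-sym G u w) wu)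

  IsIndependent-triple : ∀ {u w x}
    → u ≢ w → u ≢ x → w ≢ x
    → ¬ Edge G u w → ¬ Edge G u x → ¬ Edge G w x
    → IsIndependent G (u ∷ w ∷ x ∷ [])
  IsIndependent-triple {u} {w} {x} u≢w u≢x w≢x ¬uw ¬ux ¬wx =
    ((u≢w ∷ u≢x ∷ []) ∷ (w≢x ∷ []) ∷ [] ∷ []) , independent
    where
    independent : ∀ {s t} → s ∈ u ∷ w ∷ x ∷ [] → t ∈ u ∷ w ∷ x ∷ [] → ¬ Edge G s t
    independent (here refl)                (here refl)                = ¬Edge-refl u
    independent (here refl)                (there (here refl))        = ¬uw
    independent (here refl)                (there (there (here refl))) = ¬ux
    independent (there (here refl))        (here refl)                = ¬Edge-sym ¬uw
    independent (there (here refl))        (there (here refl))        = ¬Edge-refl w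
    independent (there (here refl))        (there (there (here refl))) = ¬wx
    independent (there (there (here refl))) (here refl)                = ¬Edge-sym ¬ux
    independent (there (there (here refl))) (there (here refl))        = ¬Edge-sym ¬wx
    independent (there (there (here refl))) (there (there (here refl))) = ¬Edge-refl x

  non-neighbours-adjacent : IndependenceNumber G 2 → ∀ {v a b}
    → v ≢ a → v ≢ b → a ≢ b
    → ¬ Edge G v a → ¬ Edge G v b → Edge G a b
  non-neighbours-adjacent α v≢a v≢b a≢b ¬va ¬vb with adj G _ _ Bool.≟ true
  ... | yes ab = ab
  ... | no ¬ab = contradiction
    (proj₂ α _ (IsIndependent-triple v≢a v≢b a≢b ¬va ¬vb ¬ab))
    (<⇒≱ (n<1+n 2))

  module _ {k : ℕ} (c : Fin n → Fin k) where

    2≤edgesToClass : ∀ {v w₁ w₂ i}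
      → w₁ ≢ w₂ → c w₁ ≡ i → c w₂ ≡ i → Edge G v w₁ → Edge G v w₂
      → 2 ≤ edgesToClass G c v i
    2≤edgesToClass {v} {i = i} w₁≢w₂ cw₁ cw₂ vw₁ vw₂ =
      distinct-∈⇒2≤length (counted cw₁ vw₁) (counted cw₂ vw₂) w₁≢w₂
      where
      counted : ∀ {w} → c w ≡ i → Edge G v w
        → w ∈ filter (λ u → (⌊ c u ≟ i ⌋ ∧ adj G v u) Bool.≟ true) (allFin n)
      counted {w} cw vw =
        ∈-filter⁺ _ (∈-allFin w)
          (cong₂ _∧_ (trans (isYes≗does (c w ≟ i)) (dec-true (c w ≟ i) cw)) vw)

    edgesToClass≡1⇒¬Edge : ∀ {v a₁ a₂}
      → PairClass c a₁ a₂ → edgesToClass G c v (c a₁) ≡ 1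
      → Edge G v a₂ → ¬ Edge G v a₁
    edgesToClass≡1⇒¬Edge (a₁≢a₂ , ca₂ , _) one va₂ va₁ =
      contradiction (2≤edgesToClass a₁≢a₂ refl ca₂ va₁ va₂)
        (λ 2≤e → <⇒≱ (n<1+n 1) (subst (2 ≤_) one 2≤e))

SingletonClass⇒≢PairClass : ∀ {n k} {c : Fin n → Fin k} {v a₁ a₂}
  → SingletonClass c v → PairClass c a₁ a₂ → v ≢ a₁
SingletonClass⇒≢PairClass singleton (a₁≢a₂ , ca₂ , _) refl = a₁≢a₂ (sym (singleton _ ca₂))

lemma3p3 : ∀ {n k} (G : Graph n) (c : Fin n → Fin k)
    → IndependenceNumber G 2
    → ChromaticNumber G k
    → IsIndependentPartition G c
    → (v a₁ a₂ b₁ b₂ : Fin n)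
    → SingletonClass c v
    → PairClass c a₁ a₂ → edgesToClass G c v (c a₁) ≡ 1
    → PairClass c b₁ b₂ → edgesToClass G c v (c b₁) ≡ 1
    → c a₁ ≢ c b₁
    → Edge G v a₂ → Edge G v b₂
    → Edge G a₁ b₁
lemma3p3 G c α _ _ v a₁ a₂ b₁ b₂ singleton pairA oneA pairB oneB ca₁≢cb₁ va₂ vb₂ =
  non-neighbours-adjacent G α
    (SingletonClass⇒≢PairClass singleton pairA)
    (SingletonClass⇒≢PairClass singleton pairB)
    (λ a₁≡b₁ → ca₁≢cb₁ (cong c a₁≡b₁))
    (edgesToClass≡1⇒¬Edge G c pairA oneA va₂)
    (edgesToClass≡1⇒¬Edge G c pairB oneB vb₂)
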